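{- Let $s\ge 2$, $l\ge 1$ and $t\ge 2$ be integers with $t\le \sqrt{s}\cdot 2^{l-2}$. Then $\operatorname{ch}(K^s_{k,t-k})\le l$ for every integer $k$ with $1\le k\le t-1$.
   Context: A hypergraph $H=(V,E)$ has finite vertex set $V$ and edge set $E\subset 2^V$. $K^s_{n,m}$ denotes the complete 2-colorable $s$-uniform hypergraph with parts of sizes $n$ and $m$: its vertex set is a disjoint union $A\cup B$ with $|A|=n$, $|B|=m$, and its edges are all $s$-element subsets of $A\cup B$ meeting both $A$ and $B$. A coloring is proper if every edge contains two vertices of different colors. $H$ is $k$-choosable if for every assignment of lists $L(v)$ of colors with $|L(v)|=k$ for all $v$ there is a proper coloring assigning each $v$ a color from $L(v)$; $\operatorname{ch}(H)$ is the minimum such $k$. -}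

module Defs where

open import Data.Nat using (ℕ; _+_; _≤_; _<_)
open import Data.Fin using (Fin; toℕ)
open import Data.Fin.Subset using (Subset; _∈_; ∣_∣)
open import Data.List using (List; length)
open import Data.List.Relation.Unary.Unique.Propositional using (Unique)
import Data.List.Membership.Propositional as LM
open import Data.Product using (Σ; ∃; _×_; ∃-syntax)
open import Relation.Binary.PropositionalEquality using (_≡_; _≢_)
open import Level using (Level; suc; zero)

record Hypergraph (N : ℕ) : Set₁ where
  field
    IsEdge : Subset N → Set

open Hypergraph public

Proper : {N : ℕ} → Hypergraph N → (Fin N → ℕ) → Set
Proper H c = ∀ e → IsEdge H e →
  ∃[ u ] ∃[ v ] (u ∈ e × v ∈ e × c u ≢ c v)

Choosable : {N : ℕ} → Hypergraph N → ℕ → Set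
Choosable {N} H k =
  (L : Fin N → List ℕ) →
  (∀ v → length (L v) ≡ k) →
  (∀ v → Unique (L v)) →
  ∃[ c ] ((∀ v → c v LM.∈ L v) × Proper H c)

-- ch(H) ≤ l, with ch(H) the minimum k such that H is k-choosable:
-- equivalently, some k ≤ l makes H k-choosable.
ch≤ : {N : ℕ} → Hypergraph N → ℕ → Set
ch≤ H l = ∃[ k ] (k ≤ l × Choosable H k)

-- K^s_{n,m}: vertex set Fin (n + m), part A = {v | toℕ v < n} (size n),
-- part B = {v | n ≤ toℕ v} (size m).  Edges: s-element subsets meeting both.
K : (s n m : ℕ) → Hypergraph (n + m)
K s n m = record
  { IsEdge = λ e → ∣ e ∣ ≡ s
                 × (∃[ a ] (a ∈ e × toℕ a < n))
                 × (∃[ b ] (b ∈ e × n ≤ toℕ b)) }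

{-# OPTIONS --safe #-}
-- Make every colour, independently, reserved for part A (probability w/D), reserved for part B
-- (probability w/D) or spare (probability e/D), where D = 2w + e, and let each vertex take a colour
-- of its list reserved for its own part if it has one, and a spare colour otherwise.  This can only
-- fail at a vertex all of whose colours are reserved for the other part ("trapped", probability
-- (w/D)^l), or on a crossing edge, which is then monochromatic in a spare colour and so consists of
-- s vertices without a colour reserved for their part ("unserved", probability ((w+e)/D)^l each).
-- Hence it suffices that the expectation of s·#trapped + #unserved is below s, i.e. that
-- t(s w^l + u^l) < s (u+w)^l with u = w + e; the method of conditional expectations, deciding one
-- colour at a time, then yields a good assignment of kinds.  For w = 2l, raising u by one at most
-- doubles u^l, so u can be chosen with u^l within a factor 4 of s w^l; together with
-- 4^l u^l w^l ≤ (u+w)^2l and 4t² ≤ s 4^(l-1) this gives the required inequality.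
module Submission where

open import Data.Bool using (Bool; true; false; not; T; if_then_else_)
open import Data.Empty using (⊥; ⊥-elim)
open import Data.Fin using (Fin; toℕ; zero; suc)
import Data.Fin.Properties as Fin
open import Data.Fin.Subset using (Subset; ∣_∣) renaming (_∈_ to _∈ₛ_)
open import Data.Fin.Subset.Properties using () renaming (_∈?_ to _∈ₛ?_)
open import Data.List using (List; []; _∷_; length; map; concat; allFin)
open import Data.List.Membership.Propositional using (_∈_; find)
open import Data.List.Membership.Propositional.Properties using (∈-allFin)
open import Data.List.Properties using (map-cong-local)
open import Data.List.Relation.Unary.All as All using (All; []; _∷_)
open import Data.List.Relation.Unary.All.Properties using (map⁻; concat⁻)
open import Data.List.Relation.Unary.AllPairs using ([]; _∷_)
open import Data.List.Relation.Unary.Any as Any using (Any; here; there)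
open import Data.List.Relation.Unary.Unique.Propositional using (Unique)
open import Data.Maybe using (Maybe; just; nothing)
open import Data.Nat
open import Data.Nat.ListAction using (product)
open import Data.Nat.Properties
open import Data.Nat.Tactic.RingSolver using (solve-∀)
open import Data.Product using (∃; ∃₂; _×_; _,_; proj₁; proj₂)
open import Data.Sum using (_⊎_; inj₁; inj₂; [_,_]′)
import Data.Vec.Base as Vec
open import Data.Vec.Base using ([]; _∷_)
open import Function using (_∘_; id)
open import Relation.Binary.PropositionalEquality
open import Relation.Nullary using (Dec; yes; no; does; ¬?; contradiction)
open import Relation.Nullary.Decidable using (T?; _×-dec_; decidable-stable)
open import Algebra.Properties.CommutativeSemigroup *-commutativeSemigroup using (x∙yz≈y∙xz)
open import Algebra.Properties.Semiring.Sum +-*-semiring using (sum; sum-cong-≗; *-distribˡ-sum; *-distribʳ-sum)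

open import Defs

-- Choice of the weights

-- Bernoulli's inequality (m/(m+1))^l ≥ 1 − l/(m+1), cleared of denominators.
bernoulli : ∀ m l → suc m ^ l * suc m ≤ m ^ l * suc m + l * suc m ^ l
bernoulli m zero = ≤-reflexive (sym (+-identityʳ (1 * suc m)))
bernoulli m (suc l) = begin
  suc m * P * suc m                               ≡⟨ *-assoc (suc m) P (suc m) ⟩
  suc m * (P * suc m)                             ≤⟨ *-monoʳ-≤ (suc m) (bernoulli m l) ⟩
  suc m * (Q * suc m + l * P)                     ≡⟨ expand m Q l P ⟩
  m * Q * suc m + (Q * suc m + l * (suc m * P))   ≤⟨ +-monoʳ-≤ (m * Q * suc m) (+-monoˡ-≤ _ Q[1+m]≤[1+m]P) ⟩
  m * Q * suc m + suc l * (suc m * P)             ∎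
  where
  open ≤-Reasoning
  P = suc m ^ l
  Q = m ^ l
  Q[1+m]≤[1+m]P : Q * suc m ≤ suc m * P
  Q[1+m]≤[1+m]P = ≤-trans (*-monoˡ-≤ (suc m) (^-monoˡ-≤ l (n≤1+n m))) (≤-reflexive (*-comm P (suc m)))
  expand : ∀ m Q l P → suc m * (Q * suc m + l * P) ≡ m * Q * suc m + (Q * suc m + l * (suc m * P))
  expand = solve-∀

[1+m]^l≤2*m^l : ∀ m l → 2 * l ≤ m → suc m ^ l ≤ 2 * m ^ l
[1+m]^l≤2*m^l m l 2l≤m = *-cancelʳ-≤ P (2 * Q) (suc m) (≤-trans (m≤m+n (P * suc m) P) P[1+m]+P≤2Q[1+m])
  where
  open ≤-Reasoning
  P = suc m ^ l
  Q = m ^ l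
  split : ∀ P m → P * suc m + P + m * P ≡ 2 * (P * suc m)
  split = solve-∀
  distrib : ∀ Q m l P → 2 * (Q * suc m + l * P) ≡ 2 * Q * suc m + 2 * l * P
  distrib = solve-∀
  P[1+m]+P≤2Q[1+m] : P * suc m + P ≤ 2 * Q * suc m
  P[1+m]+P≤2Q[1+m] = +-cancelʳ-≤ (m * P) _ _ (begin
    P * suc m + P + m * P          ≡⟨ split P m ⟩
    2 * (P * suc m)                ≤⟨ *-monoʳ-≤ 2 (bernoulli m l) ⟩
    2 * (Q * suc m + l * P)        ≡⟨ distrib Q m l P ⟩
    2 * Q * suc m + 2 * l * P      ≤⟨ +-monoʳ-≤ (2 * Q * suc m) (*-monoˡ-≤ P 2l≤m) ⟩
    2 * Q * suc m + m * P          ∎)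

m<4*n⇒0<n : ∀ {m n} → m < 4 * n → 0 < n
m<4*n⇒0<n {n = suc _} _ = z<s

n<4*n : ∀ {n} → 0 < n → n < 4 * n
n<4*n {n} 0<n = m<m+n n {3 * n} (*-monoʳ-< 3 {0} {n} 0<n)

doubling-window : ∀ (g : ℕ → ℕ) a Y n → (∀ m → a ≤ m → g (suc m) ≤ 2 * g m) →
  g a < 4 * Y → Y < 4 * g (n + a) → ∃ λ u → a ≤ u × Y < 4 * g u × g u < 4 * Y
doubling-window g a Y zero _ ga<4Y Y<4ga = a , ≤-refl , Y<4ga , ga<4Y
doubling-window g a Y (suc n) doubling ga<4Y Y<4gu with Y <? 4 * g (n + a)
... | yes Y<4g = doubling-window g a Y n doubling ga<4Y Y<4g
... | no Y≮4g = suc n + a , m≤n+m a (suc n) , Y<4gu , (begin-strict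
  g (suc n + a)    ≤⟨ doubling (n + a) (m≤n+m a n) ⟩
  2 * g (n + a)    ≤⟨ *-monoˡ-≤ (g (n + a)) {2} {4} (s≤s (s≤s z≤n)) ⟩
  4 * g (n + a)    ≤⟨ ≮⇒≥ Y≮4g ⟩
  Y                <⟨ n<4*n (m<4*n⇒0<n ga<4Y) ⟩
  4 * Y            ∎)
  where open ≤-Reasoning

m*m<n*n⇒m<n : ∀ {m n} → m * m < n * n → m < n
m*m<n*n⇒m<n m*m<n*n = ≰⇒> λ n≤m → <⇒≱ m*m<n*n (*-mono-≤ n≤m n≤m)

4*m*n≤[m+n]*[m+n] : ∀ m n → 4 * m * n ≤ (m + n) * (m + n)
4*m*n≤[m+n]*[m+n] m n = [ ordered , swapped ]′ (≤-total n m)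
  where
  ordered : ∀ {m n} → n ≤ m → 4 * m * n ≤ (m + n) * (m + n)
  ordered {n = n} n≤m with d , refl ← m≤n⇒∃[o]m+o≡n n≤m = ≤-trans (m≤m+n _ (d * d)) (≤-reflexive (square n d))
    where
    square : ∀ n d → 4 * (n + d) * n + d * d ≡ (n + d + n) * (n + d + n)
    square = solve-∀
  swapped : m ≤ n → 4 * m * n ≤ (m + n) * (m + n)
  swapped m≤n = subst₂ _≤_ (symmetry n m) (symmetry′ n m) (ordered m≤n)
    where
    symmetry : ∀ n m → 4 * n * m ≡ 4 * m * n
    symmetry = solve-∀
    symmetry′ : ∀ n m → (n + m) * (n + m) ≡ (m + n) * (m + n)
    symmetry′ = solve-∀

4^l*[m^l*n^l]≤[m+n]^l*[m+n]^l : ∀ l m n → 4 ^ l * (m ^ l * n ^ l) ≤ (m + n) ^ l * (m + n) ^ l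
4^l*[m^l*n^l]≤[m+n]^l*[m+n]^l zero m n = ≤-refl
4^l*[m^l*n^l]≤[m+n]^l*[m+n]^l (suc l) m n = begin
  4 * 4 ^ l * (m * m ^ l * (n * n ^ l))              ≡⟨ regroup (4 ^ l) m n (m ^ l) (n ^ l) ⟩
  4 * m * n * (4 ^ l * (m ^ l * n ^ l))              ≤⟨ *-mono-≤ (4*m*n≤[m+n]*[m+n] m n) (4^l*[m^l*n^l]≤[m+n]^l*[m+n]^l l m n) ⟩
  (m + n) * (m + n) * ((m + n) ^ l * (m + n) ^ l)    ≡⟨ interchange (m + n) ((m + n) ^ l) ⟩
  (m + n) * (m + n) ^ l * ((m + n) * (m + n) ^ l)    ∎
  where
  open ≤-Reasoning
  regroup : ∀ F m n M N → 4 * F * (m * M * (n * N)) ≡ 4 * m * n * (F * (M * N))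
  regroup = solve-∀
  interchange : ∀ a b → a * a * (b * b) ≡ a * b * (a * b)
  interchange = solve-∀

t*[s*Y+X]<s*E : ∀ t s F X Y E .{{_ : NonZero F}} →
  4 * (t * t) ≤ s * F → s * Y < 4 * X → X < 4 * (s * Y) → 4 * F * (X * Y) ≤ E * E →
  t * (s * Y + X) < s * E
t*[s*Y+X]<s*E t s F X Y E 4t²≤sF sY<4X X<4sY 4FXY≤E² = *-cancelˡ-< 2 _ _ (begin-strict
  2 * (t * (s * Y + X))      ≡⟨ distrib t s X Y ⟩
  s * (2 * t * Y) + 2 * t * X <⟨ +-mono-≤-< (*-monoʳ-≤ s (<⇒≤ 2tY<E)) 2tX<sE ⟩
  s * E + s * E              ≡⟨ cong (s * E +_) (sym (+-identityʳ (s * E))) ⟩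
  2 * (s * E)                ∎)
  where
  open ≤-Reasoning
  instance
    Y≢0 : NonZero Y
    Y≢0 = m*n≢0⇒n≢0 s {{>-nonZero (m<4*n⇒0<n X<4sY)}}
    s≢0 : NonZero s
    s≢0 = m*n≢0⇒m≢0 s {{>-nonZero (m<4*n⇒0<n X<4sY)}}
    X≢0 : NonZero X
    X≢0 = >-nonZero (m<4*n⇒0<n sY<4X)
  distrib : ∀ t s X Y → 2 * (t * (s * Y + X)) ≡ s * (2 * t * Y) + 2 * t * X
  distrib = solve-∀
  square : ∀ t Y → 2 * t * Y * (2 * t * Y) ≡ 4 * (t * t) * Y * Y
  square = solve-∀
  square₂ : ∀ s E → s * s * (E * E) ≡ s * E * (s * E)
  square₂ = solve-∀
  regroup : ∀ s F Y → s * F * Y ≡ F * (s * Y)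
  regroup = solve-∀
  regroup₂ : ∀ F X Y → F * (4 * X) * Y ≡ 4 * F * (X * Y)
  regroup₂ = solve-∀
  regroup₃ : ∀ s F X Y → s * F * (4 * (s * Y)) * X ≡ s * s * (4 * F * (X * Y))
  regroup₃ = solve-∀
  2tY<E : 2 * t * Y < E
  2tY<E = m*m<n*n⇒m<n (begin-strict
    2 * t * Y * (2 * t * Y)    ≡⟨ square t Y ⟩
    4 * (t * t) * Y * Y        ≤⟨ *-monoˡ-≤ Y (*-monoˡ-≤ Y 4t²≤sF) ⟩
    s * F * Y * Y              ≡⟨ cong (_* Y) (regroup s F Y) ⟩
    F * (s * Y) * Y            <⟨ *-monoˡ-< Y (*-monoʳ-< F sY<4X) ⟩
    F * (4 * X) * Y            ≡⟨ regroup₂ F X Y ⟩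
    4 * F * (X * Y)            ≤⟨ 4FXY≤E² ⟩
    E * E                      ∎)
  2tX<sE : 2 * t * X < s * E
  2tX<sE = m*m<n*n⇒m<n (begin-strict
    2 * t * X * (2 * t * X)    ≡⟨ square t X ⟩
    4 * (t * t) * X * X        ≤⟨ *-monoˡ-≤ X (*-monoˡ-≤ X 4t²≤sF) ⟩
    s * F * X * X              <⟨ *-monoˡ-< X (*-monoʳ-< (s * F) {{m*n≢0 s F}} X<4sY) ⟩
    s * F * (4 * (s * Y)) * X  ≡⟨ regroup₃ s F X Y ⟩
    s * s * (4 * F * (X * Y))  ≤⟨ *-monoʳ-≤ (s * s) 4FXY≤E² ⟩
    s * s * (E * E)            ≡⟨ square₂ s E ⟩
    s * E * (s * E)            ∎)

admissible-weights : ∀ t s l → 1 ≤ s → 1 ≤ l → 4 * (t * t) ≤ s * 4 ^ (l ∸ 1) →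
  ∃₂ λ w e → 1 ≤ w × t * (s * w ^ l + (w + e) ^ l) < s * (w + e + w) ^ l
admissible-weights t s (suc l) 1≤s _ 4t²≤s4^l =
  let u , w≤u , Y<4X , X<4Y = doubling-window (_^ suc l) w Y Y doubling w^l<4Y Y<4[Y+w]^l
  in w , u ∸ w , z<s ,
     subst (λ u → t * (s * w ^ suc l + u ^ suc l) < s * (u + w) ^ suc l) (sym (m+[n∸m]≡n w≤u))
       (t*[s*Y+X]<s*E t s (4 ^ l) (u ^ suc l) (w ^ suc l) ((u + w) ^ suc l) {{m^n≢0 4 l}}
          4t²≤s4^l Y<4X X<4Y (4^l*[m^l*n^l]≤[m+n]^l*[m+n]^l (suc l) u w))
  where
  open ≤-Reasoning
  w = 2 * suc l
  Y = s * w ^ suc l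
  instance
    s≢0 : NonZero s
    s≢0 = >-nonZero 1≤s
  doubling : ∀ m → w ≤ m → suc m ^ suc l ≤ 2 * m ^ suc l
  doubling m w≤m = [1+m]^l≤2*m^l m (suc l) w≤m
  w^l<4Y : w ^ suc l < 4 * Y
  w^l<4Y = ≤-<-trans (m≤n*m (w ^ suc l) s) (n<4*n (*-mono-< 1≤s (m^n>0 w (suc l))))
  Y<4[Y+w]^l : Y < 4 * (Y + w) ^ suc l
  Y<4[Y+w]^l = subst (λ x → Y < 4 * x ^ suc l) (+-comm w Y) (begin-strict
    Y                     <⟨ m<n+m Y {w} z<s ⟩
    w + Y                 ≤⟨ m≤m*n (w + Y) ((w + Y) ^ l) {{m^n≢0 (w + Y) l}} ⟩
    (w + Y) ^ suc l       ≤⟨ m≤n*m _ 4 ⟩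
    4 * (w + Y) ^ suc l   ∎)

sum-mono-≤ : ∀ {N} {f g : Fin N → ℕ} → (∀ i → f i ≤ g i) → sum f ≤ sum g
sum-mono-≤ {zero} _ = z≤n
sum-mono-≤ {suc N} f≤g = +-mono-≤ (f≤g zero) (sum-mono-≤ (f≤g ∘ suc))

f[i]≤sum : ∀ {N} (f : Fin N → ℕ) i → f i ≤ sum f
f[i]≤sum f zero = m≤m+n (f zero) _
f[i]≤sum f (suc i) = ≤-trans (f[i]≤sum (f ∘ suc) i) (m≤n+m _ (f zero))

sum-const : ∀ N a → sum {N} (λ _ → a) ≡ N * a
sum-const zero a = refl
sum-const (suc N) a = cong (a +_) (sum-const N a)

∣p∣≤sum : ∀ {N} (p : Subset N) (f : Fin N → ℕ) → (∀ i → i ∈ₛ p → 1 ≤ f i) → ∣ p ∣ ≤ sum f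
∣p∣≤sum [] f _ = z≤n
∣p∣≤sum (true ∷ p) f pos = +-mono-≤ (pos zero Vec.here) (∣p∣≤sum p (f ∘ suc) λ i i∈p → pos (suc i) (Vec.there i∈p))
∣p∣≤sum (false ∷ p) f pos = ≤-trans (∣p∣≤sum p (f ∘ suc) λ i i∈p → pos (suc i) (Vec.there i∈p)) (m≤n+m _ (f zero))

product-map-const : ∀ {X : Set} a (xs : List X) → product (map (λ _ → a) xs) ≡ a ^ length xs
product-map-const a [] = refl
product-map-const a (x ∷ xs) = cong (a *_) (product-map-const a xs)

-- Kinds of colours and partial assignments of kinds

data Part : Set where
  A B : Part

opposite : Part → Part
opposite A = B
opposite B = A

data Kind : Set where
  reserved : Part → Kind
  spare : Kind

reservedFor : Part → Kind → Bool
reservedFor A (reserved A) = true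
reservedFor A (reserved B) = false
reservedFor B (reserved A) = false
reservedFor B (reserved B) = true
reservedFor _ spare = false

usableBy : Part → Kind → Bool
usableBy p k = not (reservedFor (opposite p) k)

_∈ₖ_ : Maybe Kind → (Kind → Bool) → Set
just k ∈ₖ S = T (S k)
nothing ∈ₖ S = ⊥

_∈ₖ?_ : ∀ x S → Dec (x ∈ₖ S)
just k ∈ₖ? S = T? (S k)
nothing ∈ₖ? S = no id

reserved⇒usable : ∀ x p → x ∈ₖ reservedFor p → x ∈ₖ usableBy p
reserved⇒usable (just (reserved A)) A _ = _
reserved⇒usable (just (reserved B)) B _ = _

reserved⇒¬usable-by-both : ∀ x p → x ∈ₖ reservedFor p → x ∈ₖ usableBy A → x ∈ₖ usableBy B → ⊥
reserved⇒¬usable-by-both (just (reserved A)) A _ _ ()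
reserved⇒¬usable-by-both (just (reserved B)) B _ ()

SmallMonochromaticCrossings : ∀ {N} → ℕ → (Fin N → Part) → (Fin N → ℕ) → Set
SmallMonochromaticCrossings s part colour = ∀ E {a b} → a ∈ₛ E → b ∈ₛ E → part a ≡ A → part b ≡ B →
  (∀ x → x ∈ₛ E → colour x ≡ colour a) → ∣ E ∣ < s

Assignment : Set
Assignment = ℕ → Maybe Kind

_[_≔_] : Assignment → ℕ → Kind → Assignment
(τ [ c ≔ k ]) x with x ≟ c
... | yes _ = just k
... | no _ = τ x

[≔]-same : ∀ τ c k → (τ [ c ≔ k ]) c ≡ just k
[≔]-same τ c k with c ≟ c
... | yes _ = refl
... | no c≢c = ⊥-elim (c≢c refl)

[≔]-other : ∀ τ {c x} k → x ≢ c → (τ [ c ≔ k ]) x ≡ τ x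
[≔]-other τ {c} {x} k x≢c with x ≟ c
... | yes x≡c = ⊥-elim (x≢c x≡c)
... | no _ = refl

Decided : Assignment → ℕ → Set
Decided τ c = ∃ λ k → τ c ≡ just k

_⊑_ : Assignment → Assignment → Set
τ ⊑ τ′ = ∀ {c k} → τ c ≡ just k → τ′ c ≡ just k

⊑-[≔] : ∀ {τ c} k → τ c ≡ nothing → τ ⊑ (τ [ c ≔ k ])
⊑-[≔] {τ} {c} k τc≡nothing {x} τx≡just = trans ([≔]-other τ k x≢c) τx≡just
  where
  x≢c : x ≢ c
  x≢c refl = contradiction (trans (sym τc≡nothing) τx≡just) λ ()

-- The method of conditional expectations

module Weighted (w e : ℕ) where

  D : ℕ
  D = w + e + w

  Σₖ : (Kind → ℕ) → ℕ
  Σₖ g = w * g (reserved A) + e * g spare + w * g (reserved B)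

  Σₖ-cong : ∀ {g h} → (∀ k → g k ≡ h k) → Σₖ g ≡ Σₖ h
  Σₖ-cong g≗h = cong₂ _+_ (cong₂ _+_ (cong (w *_) (g≗h _)) (cong (e *_) (g≗h _))) (cong (w *_) (g≗h _))

  Σₖ-mono-≤ : ∀ {g h} → (∀ k → g k ≤ h k) → Σₖ g ≤ Σₖ h
  Σₖ-mono-≤ g≤h = +-mono-≤ (+-mono-≤ (*-monoʳ-≤ w (g≤h _)) (*-monoʳ-≤ e (g≤h _))) (*-monoʳ-≤ w (g≤h _))

  Σₖ-const : ∀ a → Σₖ (λ _ → a) ≡ D * a
  Σₖ-const a = identity w e a
    where
    identity : ∀ w e a → w * a + e * a + w * a ≡ (w + e + w) * a
    identity = solve-∀

  Σₖ-+ : ∀ g h → Σₖ (λ k → g k + h k) ≡ Σₖ g + Σₖ h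
  Σₖ-+ g h = identity w e (g (reserved A)) (g spare) (g (reserved B)) (h (reserved A)) (h spare) (h (reserved B))
    where
    identity : ∀ w e a b c a′ b′ c′ →
      w * (a + a′) + e * (b + b′) + w * (c + c′) ≡ (w * a + e * b + w * c) + (w * a′ + e * b′ + w * c′)
    identity = solve-∀

  Σₖ-*ˡ : ∀ x g → Σₖ (λ k → x * g k) ≡ x * Σₖ g
  Σₖ-*ˡ x g = identity w e x (g (reserved A)) (g spare) (g (reserved B))
    where
    identity : ∀ w e x a b c → w * (x * a) + e * (x * b) + w * (x * c) ≡ x * (w * a + e * b + w * c)
    identity = solve-∀

  Σₖ-*ʳ : ∀ x g → Σₖ (λ k → g k * x) ≡ Σₖ g * x
  Σₖ-*ʳ x g = trans (Σₖ-cong λ k → *-comm (g k) x) (trans (Σₖ-*ˡ x g) (*-comm x (Σₖ g)))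

  Σₖ-sum : ∀ {N} (G : Kind → Fin N → ℕ) → Σₖ (λ k → sum (G k)) ≡ sum (λ i → Σₖ (λ k → G k i))
  Σₖ-sum {zero} G = trans (Σₖ-const 0) (*-zeroʳ D)
  Σₖ-sum {suc N} G = trans (Σₖ-+ (λ k → G k zero) (λ k → sum (G k ∘ suc)))
                           (cong (Σₖ (λ k → G k zero) +_) (Σₖ-sum (λ k → G k ∘ suc)))

  below-average : 0 < D → ∀ g P → Σₖ g ≡ D * P → ∃ λ k → g k ≤ P
  below-average 0<D g P Σg≡DP with g (reserved A) ≤? P | g spare ≤? P | g (reserved B) ≤? P
  ... | yes gA≤P | _ | _ = reserved A , gA≤P
  ... | _ | yes gs≤P | _ = spare , gs≤P
  ... | _ | _ | yes gB≤P = reserved B , gB≤P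
  ... | no gA≰P | no gs≰P | no gB≰P = contradiction Σg≡DP (<⇒≢ (begin-strict
    D * P             <⟨ *-monoʳ-< D {{>-nonZero 0<D}} (n<1+n P) ⟩
    D * suc P         ≡⟨ Σₖ-const (suc P) ⟨
    Σₖ (λ _ → suc P)  ≤⟨ Σₖ-mono-≤ P<g ⟩
    Σₖ g              ∎) ∘ sym)
    where
    open ≤-Reasoning
    P<g : ∀ k → P < g k
    P<g (reserved A) = ≰⇒> gA≰P
    P<g spare = ≰⇒> gs≰P
    P<g (reserved B) = ≰⇒> gB≰P

  Balanced : (Assignment → ℕ) → Set
  Balanced G = ∀ τ c → τ c ≡ nothing → Σₖ (λ k → G (τ [ c ≔ k ])) ≡ D * G τ

  +-balanced : ∀ {G H} → Balanced G → Balanced H → Balanced (λ τ → G τ + H τ)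
  +-balanced {G} {H} balG balH τ c τc≡nothing = begin
    Σₖ (λ k → G (τ [ c ≔ k ]) + H (τ [ c ≔ k ]))            ≡⟨ Σₖ-+ (λ k → G (τ [ c ≔ k ])) (λ k → H (τ [ c ≔ k ])) ⟩
    Σₖ (λ k → G (τ [ c ≔ k ])) + Σₖ (λ k → H (τ [ c ≔ k ])) ≡⟨ cong₂ _+_ (balG τ c τc≡nothing) (balH τ c τc≡nothing) ⟩
    D * G τ + D * H τ                                        ≡⟨ *-distribˡ-+ D (G τ) (H τ) ⟨
    D * (G τ + H τ)                                          ∎
    where open ≡-Reasoning

  *-balanced : ∀ x {G} → Balanced G → Balanced (λ τ → x * G τ)
  *-balanced x {G} balG τ c τc≡nothing = begin
    Σₖ (λ k → x * G (τ [ c ≔ k ])) ≡⟨ Σₖ-*ˡ x (λ k → G (τ [ c ≔ k ])) ⟩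
    x * Σₖ (λ k → G (τ [ c ≔ k ])) ≡⟨ cong (x *_) (balG τ c τc≡nothing) ⟩
    x * (D * G τ)                  ≡⟨ x∙yz≈y∙xz x D (G τ) ⟩
    D * (x * G τ)                  ∎
    where open ≡-Reasoning

  sum-balanced : ∀ {N} {G : Fin N → Assignment → ℕ} → (∀ i → Balanced (G i)) → Balanced (λ τ → sum (λ i → G i τ))
  sum-balanced {G = G} balG τ c τc≡nothing = begin
    Σₖ (λ k → sum (λ i → G i (τ [ c ≔ k ]))) ≡⟨ Σₖ-sum (λ k i → G i (τ [ c ≔ k ])) ⟩
    sum (λ i → Σₖ (λ k → G i (τ [ c ≔ k ]))) ≡⟨ sum-cong-≗ (λ i → balG i τ c τc≡nothing) ⟩
    sum (λ i → D * G i τ)                    ≡⟨ *-distribˡ-sum D (λ i → G i τ) ⟨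
    D * sum (λ i → G i τ)                    ∎
    where open ≡-Reasoning

  BalancedFactor : (Maybe Kind → ℕ) → Set
  BalancedFactor f = Σₖ (f ∘ just) ≡ D * f nothing

  product-balanced : ∀ f → BalancedFactor f → ∀ {L} → Unique L → Balanced (λ τ → product (map (f ∘ τ) L))
  product-balanced f bal [] τ c _ = Σₖ-const 1
  product-balanced f bal {x ∷ L} (x∉L ∷ uniqL) τ c τc≡nothing = by-cases (x ≟ c)
    where
    open ≡-Reasoning
    Π : Assignment → ℕ
    Π τ = product (map (f ∘ τ) L)
    by-cases : Dec (x ≡ c) → Σₖ (λ k → f ((τ [ c ≔ k ]) x) * Π (τ [ c ≔ k ])) ≡ D * (f (τ x) * Π τ)
    by-cases (yes refl) = begin
      Σₖ (λ k → f ((τ [ x ≔ k ]) x) * Π (τ [ x ≔ k ])) ≡⟨ Σₖ-cong (λ k → cong₂ _*_ (cong f ([≔]-same τ x k)) (Π-unchanged k)) ⟩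
      Σₖ (λ k → f (just k) * Π τ)                       ≡⟨ Σₖ-*ʳ (Π τ) (f ∘ just) ⟩
      Σₖ (f ∘ just) * Π τ                               ≡⟨ cong (_* Π τ) bal ⟩
      D * f nothing * Π τ                               ≡⟨ cong (λ y → D * f y * Π τ) τc≡nothing ⟨
      D * f (τ x) * Π τ                                 ≡⟨ *-assoc D (f (τ x)) (Π τ) ⟩
      D * (f (τ x) * Π τ)                               ∎
      where
      Π-unchanged : ∀ k → Π (τ [ x ≔ k ]) ≡ Π τ
      Π-unchanged k = cong product (map-cong-local (All.map (λ x≢y → cong f ([≔]-other τ k (x≢y ∘ sym))) x∉L))
    by-cases (no x≢c) = begin
      Σₖ (λ k → f ((τ [ c ≔ k ]) x) * Π (τ [ c ≔ k ])) ≡⟨ Σₖ-cong (λ k → cong (λ y → f y * Π (τ [ c ≔ k ])) ([≔]-other τ k x≢c)) ⟩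
      Σₖ (λ k → f (τ x) * Π (τ [ c ≔ k ]))             ≡⟨ Σₖ-*ˡ (f (τ x)) (λ k → Π (τ [ c ≔ k ])) ⟩
      f (τ x) * Σₖ (λ k → Π (τ [ c ≔ k ]))             ≡⟨ cong (f (τ x) *_) (product-balanced f bal uniqL τ c τc≡nothing) ⟩
      f (τ x) * (D * Π τ)                               ≡⟨ x∙yz≈y∙xz (f (τ x)) D (Π τ) ⟩
      D * (f (τ x) * Π τ)                               ∎

  descend : ∀ {G} → Balanced G → 0 < D → ∀ cs τ →
    ∃ λ τ′ → τ ⊑ τ′ × G τ′ ≤ G τ × All (Decided τ′) cs
  descend balG 0<D [] τ = τ , id , ≤-refl , []
  descend {G} balG 0<D (c ∷ cs) τ with τ c in τc≡
  ... | just k =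
    let τ′ , τ⊑τ′ , Gτ′≤Gτ , decided = descend balG 0<D cs τ
    in τ′ , τ⊑τ′ , Gτ′≤Gτ , (k , τ⊑τ′ τc≡) ∷ decided
  ... | nothing =
    let k , Gτ[c≔k]≤Gτ = below-average 0<D (λ k → G (τ [ c ≔ k ])) (G τ) (balG τ c τc≡)
        τ′ , τ[c≔k]⊑τ′ , Gτ′≤Gτ[c≔k] , decided = descend balG 0<D cs (τ [ c ≔ k ])
    in τ′ , (λ τx≡ → τ[c≔k]⊑τ′ (⊑-[≔] {τ} {c} k τc≡ τx≡)) ,
       ≤-trans Gτ′≤Gτ[c≔k] Gτ[c≔k]≤Gτ ,
       (k , τ[c≔k]⊑τ′ ([≔]-same τ c k)) ∷ decided

  -- On a decided colour: D times the indicator that its kind lies outside S; on an undecided one: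
  -- the expectation of that.
  avoiding : (Kind → Bool) → Maybe Kind → ℕ
  avoiding S (just k) = if S k then 0 else D
  avoiding S nothing = Σₖ (λ k → if S k then 0 else 1)

  avoiding-balanced : ∀ S → BalancedFactor (avoiding S)
  avoiding-balanced S = trans (Σₖ-cong scaled) (Σₖ-*ˡ D (λ k → if S k then 0 else 1))
    where
    scaled : ∀ k → avoiding S (just k) ≡ D * (if S k then 0 else 1)
    scaled k with S k
    ... | true = sym (*-zeroʳ D)
    ... | false = sym (*-identityʳ D)

  avoiding-product-balanced : ∀ S {L} → Unique L → Balanced (λ τ → product (map (avoiding S ∘ τ) L))
  avoiding-product-balanced S = product-balanced (avoiding S) (avoiding-balanced S)

  avoiding-product-decided : ∀ S τ L → All (Decided τ) L →
    product (map (avoiding S ∘ τ) L) ≡ D ^ length L ⊎ Any (λ c → τ c ∈ₖ S) L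
  avoiding-product-decided S τ [] [] = inj₁ refl
  avoiding-product-decided S τ (c ∷ L) ((k , τc≡k) ∷ decided) with avoiding-product-decided S τ L decided
  ... | inj₂ found = inj₂ (there found)
  ... | inj₁ Π≡D^l rewrite τc≡k with S k in Sk≡
  ...   | true = inj₂ (here (subst (_∈ₖ S) (sym τc≡k) (subst T (sym Sk≡) _)))
  ...   | false = inj₁ (cong (D *_) Π≡D^l)

  trapped-weight : ∀ p → avoiding (usableBy p) nothing ≡ w
  trapped-weight A = identity w e
    where
    identity : ∀ w e → w * 0 + e * 0 + w * 1 ≡ w
    identity = solve-∀
  trapped-weight B = identity w e
    where
    identity : ∀ w e → w * 1 + e * 0 + w * 0 ≡ w
    identity = solve-∀

  unserved-weight : ∀ p → avoiding (reservedFor p) nothing ≡ w + e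
  unserved-weight A = identity w e
    where
    identity : ∀ w e → w * 0 + e * 1 + w * 1 ≡ w + e
    identity = solve-∀
  unserved-weight B = identity w e
    where
    identity : ∀ w e → w * 1 + e * 1 + w * 0 ≡ w + e
    identity = solve-∀

  module Potential {N} (s : ℕ) (part : Fin N → Part) (L : Fin N → List ℕ) where

    trapped unserved : Fin N → Assignment → ℕ
    trapped v τ = product (map (avoiding (usableBy (part v)) ∘ τ) (L v))
    unserved v τ = product (map (avoiding (reservedFor (part v)) ∘ τ) (L v))

    -- D^l times the conditional expectation, given τ, of s · #trapped + #unserved.
    Φ : Assignment → ℕ
    Φ τ = sum (λ v → s * trapped v τ + unserved v τ)

    Φ-balanced : (∀ v → Unique (L v)) → Balanced Φ
    Φ-balanced uniq = sum-balanced λ v →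
      +-balanced (*-balanced s (avoiding-product-balanced (usableBy (part v)) (uniq v)))
                 (avoiding-product-balanced (reservedFor (part v)) (uniq v))

    Φ-undecided : ∀ {l} → (∀ v → length (L v) ≡ l) → Φ (λ _ → nothing) ≡ N * (s * w ^ l + (w + e) ^ l)
    Φ-undecided {l} len = trans (sum-cong-≗ each) (sum-const N _)
      where
      each : ∀ v → s * trapped v (λ _ → nothing) + unserved v (λ _ → nothing) ≡ s * w ^ l + (w + e) ^ l
      each v rewrite product-map-const (avoiding (usableBy (part v)) nothing) (L v)
                   | product-map-const (avoiding (reservedFor (part v)) nothing) (L v)
                   | trapped-weight (part v) | unserved-weight (part v) | len v = refl

    module Descended {l} (len : ∀ v → length (L v) ≡ l) (τ : Assignment)
                   (decided : ∀ v → All (Decided τ) (L v)) (Φτ<sD^l : Φ τ < s * D ^ l) where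

      Served : Fin N → Set
      Served v = Any (λ c → τ c ∈ₖ reservedFor (part v)) (L v)

      served? : ∀ v → Dec (Served v)
      served? v = Any.any? (λ c → τ c ∈ₖ? reservedFor (part v)) (L v)

      escape : ∀ v → Any (λ c → τ c ∈ₖ usableBy (part v)) (L v)
      escape v with avoiding-product-decided (usableBy (part v)) τ (L v) (decided v)
      ... | inj₂ found = found
      ... | inj₁ trapped≡D^l = contradiction Φτ<sD^l (≤⇒≯ (begin
        s * D ^ l                       ≡⟨ cong (s *_) (trans trapped≡D^l (cong (D ^_) (len v))) ⟨
        s * trapped v τ                 ≤⟨ m≤m+n _ (unserved v τ) ⟩
        s * trapped v τ + unserved v τ  ≤⟨ f[i]≤sum (λ v → s * trapped v τ + unserved v τ) v ⟩
        Φ τ                             ∎))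
        where open ≤-Reasoning

      choice : ∀ v → ∃ λ c → c ∈ L v × τ c ∈ₖ usableBy (part v) × (Served v → τ c ∈ₖ reservedFor (part v))
      choice v with served? v
      ... | yes served = let c , c∈L , r = find served in c , c∈L , reserved⇒usable (τ c) (part v) r , λ _ → r
      ... | no ¬served = let c , c∈L , u = find (escape v) in c , c∈L , u , λ served → contradiction served ¬served

      colour : Fin N → ℕ
      colour v = proj₁ (choice v)

      colour∈L : ∀ v → colour v ∈ L v
      colour∈L v = proj₁ (proj₂ (choice v))

      colour-usable : ∀ v → τ (colour v) ∈ₖ usableBy (part v)
      colour-usable v = proj₁ (proj₂ (proj₂ (choice v)))

      colour-reserved : ∀ v → Served v → τ (colour v) ∈ₖ reservedFor (part v)
      colour-reserved v = proj₂ (proj₂ (proj₂ (choice v)))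

      unservedIndicator : Fin N → ℕ
      unservedIndicator v = if does (served? v) then 0 else 1

      unservedIndicator≤ : ∀ v → unservedIndicator v * D ^ l ≤ unserved v τ
      unservedIndicator≤ v with served? v
      ... | yes _ = z≤n
      ... | no ¬served with avoiding-product-decided (reservedFor (part v)) τ (L v) (decided v)
      ...   | inj₁ unserved≡D^l = ≤-reflexive (trans (+-identityʳ (D ^ l)) (sym (trans unserved≡D^l (cong (D ^_) (len v)))))
      ...   | inj₂ served = contradiction served ¬served

      few-unserved : sum unservedIndicator < s
      few-unserved = *-cancelʳ-< (D ^ l) (sum unservedIndicator) s (begin-strict
        sum unservedIndicator * D ^ l            ≡⟨ *-distribʳ-sum (D ^ l) unservedIndicator ⟩
        sum (λ v → unservedIndicator v * D ^ l)  ≤⟨ sum-mono-≤ (λ v → ≤-trans (unservedIndicator≤ v) (m≤n+m _ _)) ⟩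
        Φ τ                                      <⟨ Φτ<sD^l ⟩
        s * D ^ l                                ∎)
        where open ≤-Reasoning

      crossing-monochromatic-small : ∀ E {a b} → a ∈ₛ E → b ∈ₛ E → part a ≡ A → part b ≡ B →
        (∀ x → x ∈ₛ E → colour x ≡ colour a) → ∣ E ∣ < s
      crossing-monochromatic-small E {a} {b} a∈E b∈E a∈A b∈B monochromatic =
        ≤-<-trans (∣p∣≤sum E unservedIndicator unserved-in-E) few-unserved
        where
        usable-by-A : τ (colour a) ∈ₖ usableBy A
        usable-by-A = subst (λ p → τ (colour a) ∈ₖ usableBy p) a∈A (colour-usable a)
        usable-by-B : τ (colour a) ∈ₖ usableBy B
        usable-by-B = subst₂ (λ c p → τ c ∈ₖ usableBy p) (monochromatic b b∈E) b∈B (colour-usable b)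
        unserved-in-E : ∀ x → x ∈ₛ E → 1 ≤ unservedIndicator x
        unserved-in-E x x∈E with served? x
        ... | no _ = ≤-refl
        ... | yes served = ⊥-elim (reserved⇒¬usable-by-both (τ (colour a)) (part x)
                (subst (λ c → τ c ∈ₖ reservedFor (part x)) (monochromatic x x∈E) (colour-reserved x served))
                usable-by-A usable-by-B)

    colouring-exists : (∀ v → Unique (L v)) → ∀ {l} → (∀ v → length (L v) ≡ l) → 0 < D →
      N * (s * w ^ l + (w + e) ^ l) < s * D ^ l →
      ∃ λ colour → (∀ v → colour v ∈ L v) × SmallMonochromaticCrossings s part colour
    colouring-exists uniq {l} len 0<D bound =
      let τ , _ , Φτ≤Φ₀ , decided = descend (Φ-balanced uniq) 0<D (concat (map L (allFin N))) (λ _ → nothing)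
          open Descended len τ (λ v → All.lookup (map⁻ (concat⁻ decided)) (∈-allFin v))
                 (≤-<-trans Φτ≤Φ₀ (subst (_< s * D ^ l) (sym (Φ-undecided len)) bound))
      in colour , colour∈L , crossing-monochromatic-small

-- Complete 2-colourable hypergraphs

side : ∀ n {m} → Fin (n + m) → Part
side n v with toℕ v <? n
... | yes _ = A
... | no _ = B

side-A : ∀ n {m} (v : Fin (n + m)) → toℕ v < n → side n v ≡ A
side-A n v v<n with toℕ v <? n
... | yes _ = refl
... | no v≮n = contradiction v<n v≮n

side-B : ∀ n {m} (v : Fin (n + m)) → n ≤ toℕ v → side n v ≡ B
side-B n v n≤v with toℕ v <? n
... | yes v<n = contradiction n≤v (<⇒≱ v<n)
... | no _ = refl

small-crossings⇒proper : ∀ s n m (colour : Fin (n + m) → ℕ) →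
  SmallMonochromaticCrossings s (side n) colour → Proper (K s n m) colour
small-crossings⇒proper s n m colour small E (∣E∣≡s , (a , a∈E , a<n) , (b , b∈E , n≤b))
  with Fin.any? (λ x → (x ∈ₛ? E) ×-dec ¬? (colour x ≟ colour a))
... | yes (x , x∈E , x≢a) = x , a , x∈E , a∈E , x≢a
... | no ¬split = contradiction ∣E∣≡s (<⇒≢ (small E a∈E b∈E (side-A n a a<n) (side-B n b n≤b) monochromatic))
  where
  monochromatic : ∀ x → x ∈ₛ E → colour x ≡ colour a
  monochromatic x x∈E = decidable-stable (colour x ≟ colour a) (λ x≢a → ¬split (x , x∈E , x≢a))

K-choosable : ∀ s n m l w e → 1 ≤ w →
  (n + m) * (s * w ^ l + (w + e) ^ l) < s * (w + e + w) ^ l → Choosable (K s n m) l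
K-choosable s n m l w e 1≤w bound L len uniq =
  let colour , colour∈L , small = colouring-exists uniq len 0<D bound
  in colour , colour∈L , small-crossings⇒proper s n m colour small
  where
  open Weighted w e
  open Potential s (side n) L
  0<D : 0 < D
  0<D = ≤-trans 1≤w (≤-trans (m≤m+n w e) (m≤m+n (w + e) w))

-- The argument does not need the hypotheses 1 ≤ k and 2 ≤ t.
corollary2 : (s l t : ℕ) → 2 ≤ s → 1 ≤ l → 2 ≤ t →
    4 * (t * t) ≤ s * 4 ^ (l ∸ 1) →
    (k : ℕ) → 1 ≤ k → k ≤ t ∸ 1 →
    ch≤ (K s k (t ∸ k)) l
corollary2 s l t 2≤s 1≤l _ 4t²≤s4^[l-1] k _ k≤t-1 =
  let w , e , 1≤w , bound = admissible-weights t s l (≤-trans (s≤s z≤n) 2≤s) 1≤l 4t²≤s4^[l-1]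
  in l , ≤-refl , K-choosable s k (t ∸ k) l w e 1≤w
       (subst (λ N → N * (s * w ^ l + (w + e) ^ l) < s * (w + e + w) ^ l) (sym k+[t∸k]≡t) bound)
  where
  k+[t∸k]≡t : k + (t ∸ k) ≡ t
  k+[t∸k]≡t = m+[n∸m]≡n (≤-trans k≤t-1 (m∸n≤m t 1))
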